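{- Let $x,z\in{}^\omega(\omega-\{0\})$ with $x\ll z$. Suppose that $T$ is an $x$-sized tree and that $T_n$ is an $x$-sized tree for every $n\in\omega$. Then there are a $z$-sized tree $T^*\supseteq T$ and a sequence of integers $\langle m_i: i\in\omega\rangle$ such that for every $\eta\in T$, every $i\in\omega$ and every $\nu\in T_{m_i}$ extending $\eta$, if the length of $\eta$ is at least $m_i$ then $\nu\in T^*$.
   Context: For $x,y\in{}^\omega(\omega-\{0\})$, $x\ll y$ means $x(n)\le y(n)$ for all $n$ and $\lim_{n\to\infty}y(n)/x(n)=\infty$. A tree is a subset of ${}^{<\omega}\omega$ closed under initial segments. For $x\in{}^\omega(\omega-\{0\})$, a tree $T$ is $x$-sized iff $|T\cap{}^n\omega|\le x(n)$ for every $n\in\omega$. -}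

module Defs where

open import Data.Nat using (ℕ; _≤_; _<_; _*_)
open import Data.List using (List; _++_; length)
open import Data.List.Relation.Unary.All using (All)
open import Data.List.Relation.Unary.Unique.Propositional using (Unique)
open import Data.Product using (Σ; _×_; ∃)
open import Relation.Binary.PropositionalEquality using (_≡_)

-- Elements of ω^{<ω} are lists of naturals; a subset is a predicate.
Seq : Set
Seq = List ℕ

Positive : (ℕ → ℕ) → Set
Positive x = (n : ℕ) → 0 < x n

-- x ≪ y : x(n) ≤ y(n) for all n and lim y(n)/x(n) = ∞, the limit written
-- out as: for every K there is N with K·x(n) ≤ y(n) for all n ≥ N.
_≪_ : (ℕ → ℕ) → (ℕ → ℕ) → Set
x ≪ y = ((n : ℕ) → x n ≤ y n)
      × ((K : ℕ) → Σ ℕ λ N → (n : ℕ) → N ≤ n → K * x n ≤ y n)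

_⊑_ : Seq → Seq → Set
η ⊑ ν = ∃ λ ρ → η ++ ρ ≡ ν

IsTree : (Seq → Set) → Set
IsTree T = (η ν : Seq) → η ⊑ ν → T ν → T η

-- |T ∩ ω^n| ≤ x(n) for all n: every duplicate-free list of elements of
-- T of length n has at most x(n) entries
Sized : (ℕ → ℕ) → (Seq → Set) → Set
Sized x T = (n : ℕ) (l : List Seq) → Unique l →
            All (λ s → T s × length s ≡ n) l → length l ≤ x n

-- Let T* be T together with the nodes ν ∈ T_{mᵢ} that extend some η ∈ T
-- with mᵢ ≤ |η| (the graft of the T_{mᵢ} onto T).  The graft of trees is a tree
-- for any choice of indices.  For the size bound, a node of level n grafted
-- from T_{mᵢ} has mᵢ ≤ |η| ≤ n, so if n < m_j then level n of T* is covered by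
-- level n of T together with the levels n of T_{m₀}, …, T_{m_{j-1}}; counting
-- gives at most (j+1)·x(n) nodes.  Choosing the mᵢ strictly increasing with
-- mᵢ beyond the point from which (i+2)·x ≤ z, the least j with n < m_j
-- satisfies (j+1)·x(n) ≤ z(n).
module Submission where

open import Defs
open import Data.Nat using (ℕ; zero; suc; _+_; _*_; _≤_; _<_; z≤n; s≤s; _≟_)
open import Data.Nat.Properties
  using (≤-refl; ≤-trans; ≤-<-trans; <⇒≤; <⇒≱; ≰⇒>; ≰⇒≥; ≤-pred; m≤m+n; m≤n+m; +-suc
        ; +-mono-≤; *-identityˡ; ≤-reflexive; m≤n⇒m<n∨m≡n; n≢0⇒n>0; _≤?_)
open import Data.List using (List; []; _∷_; length)
open import Data.List.Properties using (length-++; ∷-injective)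
open import Data.List.Relation.Unary.All using (All; []; _∷_)
import Data.List.Relation.Unary.All as All
open import Data.List.Relation.Unary.AllPairs using ([]; _∷_)
open import Data.List.Relation.Unary.Unique.Propositional using (Unique)
open import Data.List.Relation.Binary.Sublist.Propositional using ([]; _∷_; _∷ʳ_)
  renaming (_⊆_ to _⊑ₗ_)
open import Data.List.Relation.Binary.Sublist.Propositional.Properties using (All-resp-⊆)
open import Data.Product using (Σ; _×_; _,_; proj₁; proj₂; ∃₂)
import Data.Product as Product
open import Data.Sum using (_⊎_; inj₁; inj₂)
open import Relation.Nullary using (yes; no)
open import Level using (0ℓ)
open import Relation.Unary using (Pred; _⊆_; _∪_)
open import Relation.Binary.PropositionalEquality using (_≡_; refl; sym; cong; subst)

⊑-length : {η ν : Seq} → η ⊑ ν → length η ≤ length ν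
⊑-length {η} (ρ , refl) = subst (length η ≤_) (sym (length-++ η)) (m≤m+n _ _)

⊑-comparable : (ρ η : Seq) {ν : Seq} → ρ ⊑ ν → η ⊑ ν → length ρ ≤ length η → ρ ⊑ η
⊑-comparable []      η       _          _        _         = η , refl
⊑-comparable (a ∷ ρ) (b ∷ η) (r , refl) (s , eq) (s≤s ρ≤η) with ∷-injective eq
... | refl , eq′ = Product.map₂ (cong (a ∷_)) (⊑-comparable ρ η (r , refl) (s , eq′) ρ≤η)

AtMost : {A : Set} → ℕ → Pred A 0ℓ → Set
AtMost {A} k P = (l : List A) → Unique l → All P l → length l ≤ k

Level : ℕ → Pred Seq 0ℓ → Pred Seq 0ℓ
Level n P s = P s × length s ≡ n

unique-⊑ₗ : {A : Set} {xs ys : List A} → xs ⊑ₗ ys → Unique ys → Unique xs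
unique-⊑ₗ []           []        = []
unique-⊑ₗ (_ ∷ʳ xs⊑ys) (_ ∷ u)   = unique-⊑ₗ xs⊑ys u
unique-⊑ₗ (refl ∷ xs⊑ys) (a ∷ u) = All-resp-⊆ xs⊑ys a ∷ unique-⊑ₗ xs⊑ys u

split : {A : Set} {P Q : Pred A 0ℓ} (l : List A) → All (P ∪ Q) l →
        ∃₂ λ l₁ l₂ → l₁ ⊑ₗ l × l₂ ⊑ₗ l × All P l₁ × All Q l₂ ×
                     length l ≤ length l₁ + length l₂
split []      []            = [] , [] , [] , [] , [] , [] , z≤n
split (a ∷ l) (inj₁ p ∷ ps) with split l ps
... | l₁ , l₂ , s₁ , s₂ , a₁ , a₂ , len = a ∷ l₁ , l₂ , refl ∷ s₁ , a ∷ʳ s₂ , p ∷ a₁ , a₂ , s≤s len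
split (a ∷ l) (inj₂ q ∷ ps) with split l ps
... | l₁ , l₂ , s₁ , s₂ , a₁ , a₂ , len =
  l₁ , a ∷ l₂ , a ∷ʳ s₁ , refl ∷ s₂ , a₁ , q ∷ a₂ ,
  ≤-trans (s≤s len) (≤-reflexive (sym (+-suc (length l₁) (length l₂))))

atMost-mono : {A : Set} {P Q : Pred A 0ℓ} {k k′ : ℕ} → Q ⊆ P → k ≤ k′ → AtMost k P → AtMost k′ Q
atMost-mono Q⊆P k≤k′ bound l u qs = ≤-trans (bound l u (All.map Q⊆P qs)) k≤k′

atMost-∪ : {A : Set} {P Q : Pred A 0ℓ} {a b : ℕ} → AtMost a P → AtMost b Q → AtMost (a + b) (P ∪ Q)
atMost-∪ boundP boundQ l u ps with split l ps
... | l₁ , l₂ , s₁ , s₂ , a₁ , a₂ , len =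
  ≤-trans len (+-mono-≤ (boundP l₁ (unique-⊑ₗ s₁ u) a₁) (boundQ l₂ (unique-⊑ₗ s₂ u) a₂))

Below : {A : Set} → ℕ → (ℕ → Pred A 0ℓ) → Pred A 0ℓ
Below j F a = Σ ℕ λ i → i < j × F i a

atMost-Below : {A : Set} {F : ℕ → Pred A 0ℓ} {k : ℕ} →
               ((i : ℕ) → AtMost k (F i)) → (j : ℕ) → AtMost (j * k) (Below j F)
atMost-Below bounds zero    []      _ _                  = z≤n
atMost-Below bounds zero    (_ ∷ _) _ ((_ , () , _) ∷ _)
atMost-Below {F = F} bounds (suc j) =
  atMost-mono peel ≤-refl (atMost-∪ (bounds j) (atMost-Below bounds j))
  where
  peel : Below (suc j) F ⊆ F j ∪ Below j F
  peel (i , i<1+j , f) with m≤n⇒m<n∨m≡n (≤-pred i<1+j)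
  ... | inj₁ i<j  = inj₂ (i , i<j , f)
  ... | inj₂ refl = inj₁ f

StrictlyIncreasing : (ℕ → ℕ) → Set
StrictlyIncreasing f = (i : ℕ) → f i < f (suc i)

module Increasing {f : ℕ → ℕ} (increasing : StrictlyIncreasing f) where

  monotone : {i j : ℕ} → i ≤ j → f i ≤ f j
  monotone {j = zero} z≤n = ≤-refl
  monotone {j = suc j} i≤1+j with m≤n⇒m<n∨m≡n i≤1+j
  ... | inj₁ i<1+j = ≤-trans (monotone (≤-pred i<1+j)) (<⇒≤ (increasing j))
  ... | inj₂ refl  = ≤-refl

  reflects-< : {i j : ℕ} → f i < f j → i < j
  reflects-< fi<fj = ≰⇒> (λ j≤i → <⇒≱ fi<fj (monotone j≤i))

  InBracket : ℕ → Set
  InBracket n = Σ ℕ λ k → f k ≤ n × n < f (suc k)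

  starts-bracket : {n : ℕ} (k : ℕ) → n ≡ f k → InBracket n
  starts-bracket k n≡fk = k , ≤-reflexive (sym n≡fk) , subst (_< f (suc k)) (sym n≡fk) (increasing k)

  bracket : (n : ℕ) → n < f 0 ⊎ InBracket n
  bracket zero with f 0 ≟ 0
  ... | no  f0≢0 = inj₁ (n≢0⇒n>0 f0≢0)
  ... | yes f0≡0 = inj₂ (starts-bracket 0 (sym f0≡0))
  bracket (suc n) with bracket n
  ... | inj₁ n<f0 with m≤n⇒m<n∨m≡n n<f0
  ...   | inj₁ 1+n<f0 = inj₁ 1+n<f0
  ...   | inj₂ 1+n≡f0 = inj₂ (starts-bracket 0 1+n≡f0)
  bracket (suc n) | inj₂ (k , fk≤n , n<f1+k) with m≤n⇒m<n∨m≡n n<f1+k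
  ...   | inj₁ 1+n<f1+k = inj₂ (k , ≤-trans fk≤n (m≤n+m n 1) , 1+n<f1+k)
  ...   | inj₂ 1+n≡f1+k = inj₂ (starts-bracket (suc k) 1+n≡f1+k)

dominating : (ℕ → ℕ) → ℕ → ℕ
dominating g zero    = g zero
dominating g (suc i) = suc (dominating g i) + g (suc i)

dominating-increasing : (g : ℕ → ℕ) → StrictlyIncreasing (dominating g)
dominating-increasing g i = m≤m+n _ _

dominating-≥ : (g : ℕ → ℕ) (i : ℕ) → g i ≤ dominating g i
dominating-≥ g zero    = ≤-refl
dominating-≥ g (suc i) = m≤n+m _ _

Graft : (T : Pred Seq 0ℓ) (S : ℕ → Pred Seq 0ℓ) (m : ℕ → ℕ) → Pred Seq 0ℓ
Graft T S m ν = T ν ⊎ Σ ℕ λ i → S (m i) ν × Σ Seq λ η → T η × η ⊑ ν × m i ≤ length η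

-- A graft of trees is a tree: an initial segment ρ of a grafted node ν ⊒ η
-- is either an initial segment of η, hence in T, or extends η.
graft-isTree : {T : Pred Seq 0ℓ} {S : ℕ → Pred Seq 0ℓ} (m : ℕ → ℕ) →
               IsTree T → ((n : ℕ) → IsTree (S n)) → IsTree (Graft T S m)
graft-isTree m treeT treeS ρ ν ρ⊑ν (inj₁ tν) = inj₁ (treeT ρ ν ρ⊑ν tν)
graft-isTree m treeT treeS ρ ν ρ⊑ν (inj₂ (i , sν , η , tη , η⊑ν , mi≤η)) with length ρ ≤? length η
... | yes ρ≤η = inj₁ (treeT ρ η (⊑-comparable ρ η ρ⊑ν η⊑ν ρ≤η) tη)
... | no  ρ≰η = inj₂ (i , treeS (m i) ρ ν ρ⊑ν sν , η , tη , ⊑-comparable η ρ η⊑ν ρ⊑ν (≰⇒≥ ρ≰η) , mi≤η)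

graft-level : {T : Pred Seq 0ℓ} {S : ℕ → Pred Seq 0ℓ} {m : ℕ → ℕ} → StrictlyIncreasing m →
              (n j : ℕ) → n < m j →
              Level n (Graft T S m) ⊆ Level n T ∪ Below j (λ i → Level n (S (m i)))
graft-level increasing n j n<mj (inj₁ tν , refl) = inj₁ (tν , refl)
graft-level increasing n j n<mj (inj₂ (i , sν , η , _ , η⊑ν , mi≤η) , refl) =
  inj₂ (i , Increasing.reflects-< increasing (≤-<-trans (≤-trans mi≤η (⊑-length η⊑ν)) n<mj) , sν , refl)

module Construction (x z : ℕ → ℕ) (x≪z : x ≪ z) where

  threshold : ℕ → ℕ
  threshold K = proj₁ (proj₂ x≪z K)

  beyond-threshold : (K n : ℕ) → threshold K ≤ n → K * x n ≤ z n
  beyond-threshold K = proj₂ (proj₂ x≪z K)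

  m : ℕ → ℕ
  m = dominating (λ i → threshold (2 + i))

  m-increasing : StrictlyIncreasing m
  m-increasing = dominating-increasing _

  budget : (n : ℕ) → Σ ℕ λ j → n < m j × suc j * x n ≤ z n
  budget n with Increasing.bracket m-increasing n
  ... | inj₁ n<m0 = 0 , n<m0 , subst (_≤ z n) (sym (*-identityˡ (x n))) (proj₁ x≪z n)
  ... | inj₂ (k , mk≤n , n<m1+k) =
    suc k , n<m1+k , beyond-threshold (2 + k) n (≤-trans (dominating-≥ _ k) mk≤n)

  graft-sized : (T : Pred Seq 0ℓ) (S : ℕ → Pred Seq 0ℓ) →
                Sized x T → ((n : ℕ) → Sized x (S n)) → Sized z (Graft T S m)
  graft-sized T S sizedT sizedS n with budget n
  ... | j , n<mj , fits =
    atMost-mono (graft-level {T} {S} m-increasing n j n<mj) fits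
      (atMost-∪ (sizedT n) (atMost-Below (λ i → sizedS (m i) n) j))

lemma4p8 : (x z : ℕ → ℕ) → Positive x → Positive z → x ≪ z →
    (T : Seq → Set) → IsTree T → Sized x T →
    (Tn : ℕ → Seq → Set) → ((n : ℕ) → IsTree (Tn n)) → ((n : ℕ) → Sized x (Tn n)) →
    Σ (Seq → Set) λ Tstar → Σ (ℕ → ℕ) λ m →
      IsTree Tstar × Sized z Tstar × ((η : Seq) → T η → Tstar η) ×
      ((η : Seq) → T η → (i : ℕ) → (ν : Seq) → Tn (m i) ν → η ⊑ ν →
        m i ≤ length η → Tstar ν)
lemma4p8 x z _ _ x≪z T treeT sizedT Tn treeTn sizedTn =
  Graft T Tn m , m ,
  graft-isTree m treeT treeTn ,
  graft-sized T Tn sizedT sizedTn ,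
  (λ η tη → inj₁ tη) ,
  (λ η tη i ν tν η⊑ν mi≤η → inj₂ (i , tν , η , tη , η⊑ν , mi≤η))
  where open Construction x z x≪z
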